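{- Every finitely satisfiable $\mathsf{BST}^{\otimes}$-conjunction is fulfilled by an accessible ordered $\otimes$-graph.
   Context: Sets are elements of the von Neumann universe of well-founded sets. For sets $s,t$, $s\otimes t:=\{\{u,v\} : u\in s,\ v\in t\}$. A $\mathsf{BST}^{\otimes}$-conjunction is a finite conjunction of literals $x=y\cup z$, $x=y\setminus z$, $x=y\otimes z$, $x\neq y$ ($x,y,z$ set variables); it is finitely satisfiable if some assignment $M$ of well-founded sets to its variables makes all literals true and $\bigcup_v Mv$ is finite. A $\otimes$-graph $\mathcal{G}=(\mathcal{P},\mathcal{N},\mathcal{T})$: a set of places $\mathcal{P}$, nodes $\mathcal{N}=\mathcal{P}\otimes\mathcal{P}$ (nonempty subsets of $\mathcal{P}$ of size at most 2), $\mathcal{P}\cap\mathcal{N}=\emptyset$, and a target map $\mathcal{T}:\mathcal{N}\to\mathcal{P}(\mathcal{P})$. Source places are places in no $\mathcal{T}(B)$. Accessible places form the least set containing the source places and containing $\mathcal{T}(B)$ whenever all places of node $B$ are in it; $\mathcal{G}$ is accessible if all places are accessible. A topological $\otimes$-order is a total order $\prec$ on $\mathcal{P}$ with $\max_\prec A\prec\max_\prec\mathcal{T}(A)$ for every node $A$ with $\mathcal{T}(A)\ne\emptyset$; an ordered $\otimes$-graph is a $\otimes$-graph endowed with such an order. An accessible $\mathcal{G}$ fulfills a conjunction $\Phi$ if there is $\mathfrak{F}:\mathrm{Vars}(\Phi)\to\mathcal{P}(\mathcal{P})$ with: (a) $\mathfrak{F}(x)=\mathfrak{F}(y)\star\mathfrak{F}(z)$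 for each conjunct $x=y\star z$, $\star\in\{\cup,\setminus\}$; (b) $\mathfrak{F}(x)\ne\mathfrak{F}(y)$ for each conjunct $x\neq y$; (c) for each conjunct $x=y\otimes z$: (c1) $\emptyset\neq\mathcal{T}(\{\upsilon,\zeta\})\subseteq\mathfrak{F}(x)$ for all $\upsilon\in\mathfrak{F}(y),\zeta\in\mathfrak{F}(z)$; (c2) $\mathfrak{F}(x)\subseteq\bigcup\{\mathcal{T}(B):B\in\mathfrak{F}(y)\otimes\mathfrak{F}(z)\}$; (c3) $\bigcup\{\mathcal{T}(B):B\in\mathcal{N}\setminus(\mathfrak{F}(y)\otimes\mathfrak{F}(z))\}\cap\mathfrak{F}(x)=\emptyset$. -}

module Defs where

open import Data.Bool using (Bool; true; false; if_then_else_)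
open import Data.Nat using (ℕ)
open import Data.Fin using (Fin)
open import Data.Fin.Subset using (Subset; _∈_; _∉_; _⊆_; _∪_; _─_; Nonempty)
open import Data.List using (List)
open import Data.List.Relation.Unary.All using (All)
open import Data.List.Relation.Unary.Any using (Any)
open import Data.Product using (Σ; _×_; _,_)
open import Data.Sum using (_⊎_)
open import Relation.Nullary using (¬_)
open import Relation.Binary.PropositionalEquality using (_≡_; _≢_)
open import Relation.Binary.Structures using (IsStrictTotalOrder)
open import Level using (0ℓ; suc; Lift)

-- Well-founded sets: Aczel's iterative sets (W-type of sets indexed by
-- small types), with extensional equality defined by bisimulation.

data V : Set₁ where
  sup : (A : Set) → (A → V) → V

infix 4 _≐_ _∈V_

_≐_ : V → V → Set
sup A f ≐ sup B g =
  ((a : A) → Σ B λ b → f a ≐ g b) × ((b : B) → Σ A λ a → f a ≐ g b)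

_∈V_ : V → V → Set
x ∈V sup A f = Σ A λ a → x ≐ f a

pairV : V → V → V
pairV u v = sup Bool (λ b → if b then u else v)

data Literal (n : ℕ) : Set where
  _≔_∪_ : Fin n → Fin n → Fin n → Literal n
  _≔_∖_ : Fin n → Fin n → Fin n → Literal n
  _≔_⊗_ : Fin n → Fin n → Fin n → Literal n
  _≠_   : Fin n → Fin n → Literal n

Conjunction : ℕ → Set
Conjunction n = List (Literal n)

SatLit : ∀ {n} → (Fin n → V) → Literal n → Set₁
SatLit M (x ≔ y ∪ z) = (w : V) →
  (w ∈V M x → (w ∈V M y ⊎ w ∈V M z)) × ((w ∈V M y ⊎ w ∈V M z) → w ∈V M x)
SatLit M (x ≔ y ∖ z) = (w : V) →
  (w ∈V M x → (w ∈V M y × ¬ (w ∈V M z))) × ((w ∈V M y × ¬ (w ∈V M z)) → w ∈V M x)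
SatLit M (x ≔ y ⊗ z) = (w : V) →
  (w ∈V M x → Σ V λ u → Σ V λ v → u ∈V M y × v ∈V M z × w ≐ pairV u v)
  × ((Σ V λ u → Σ V λ v → u ∈V M y × v ∈V M z × w ≐ pairV u v) → w ∈V M x)
SatLit M (x ≠ y) = Lift (suc 0ℓ) (¬ (M x ≐ M y))

FiniteUnion : ∀ {n} → (Fin n → V) → Set₁
FiniteUnion {n} M = Σ (List V) λ L →
  (i : Fin n) (w : V) → w ∈V M i → Any (w ≐_) L

FinitelySatisfiable : ∀ {n} → Conjunction n → Set₁
FinitelySatisfiable {n} Φ =
  Σ (Fin n → V) λ M → All (SatLit M) Φ × FiniteUnion M

-- Ordered ⊗-graphs with places Fin p.
-- A node {u , v} (u, v places, possibly u = v) is represented by the pair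
-- (u , v); the target map is required to be symmetric, so it is a function
-- of the unordered pair {u , v}.

SameNode : ∀ {p} → Fin p → Fin p → Fin p → Fin p → Set
SameNode u v u' v' = (u ≡ u' × v ≡ v') ⊎ (u ≡ v' × v ≡ u')

IsMax : ∀ {p} → (Fin p → Fin p → Set) → (Fin p → Set) → Fin p → Set
IsMax {p} _≺_ P m = P m × ((a : Fin p) → P a → (a ≡ m ⊎ a ≺ m))

record OrderedGraph (p : ℕ) : Set₁ where
  field
    T      : Fin p → Fin p → Subset p
    T-sym  : (u v : Fin p) → T u v ≡ T v u
    _≺_    : Fin p → Fin p → Set
    ≺-sto  : IsStrictTotalOrder _≡_ _≺_
    topo   : (u v : Fin p) → Nonempty (T u v) → (m m' : Fin p) →
             IsMax _≺_ (λ a → a ≡ u ⊎ a ≡ v) m →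
             IsMax _≺_ (λ a → a ∈ T u v) m' → m ≺ m'

module _ {p : ℕ} (G : OrderedGraph p) where
  open OrderedGraph G

  Source : Fin p → Set
  Source q = (u v : Fin p) → q ∉ T u v

  data Accessible : Fin p → Set where
    src  : ∀ {q} → Source q → Accessible q
    step : ∀ {q} (u v : Fin p) → Accessible u → Accessible v →
           q ∈ T u v → Accessible q

  IsAccessible : Set
  IsAccessible = (q : Fin p) → Accessible q

  InProd : Subset p → Subset p → Fin p → Fin p → Set
  InProd Y Z u v = Σ (Fin p) λ υ → Σ (Fin p) λ ζ →
    υ ∈ Y × ζ ∈ Z × SameNode u v υ ζ

  FulfillsLit : ∀ {n} → (Fin n → Subset p) → Literal n → Set
  FulfillsLit F (x ≔ y ∪ z) = F x ≡ F y ∪ F z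
  FulfillsLit F (x ≔ y ∖ z) = F x ≡ F y ─ F z
  FulfillsLit F (x ≔ y ⊗ z) =
    ((υ ζ : Fin p) → υ ∈ F y → ζ ∈ F z → Nonempty (T υ ζ) × T υ ζ ⊆ F x)
    × ((q : Fin p) → q ∈ F x →
        Σ (Fin p) λ υ → Σ (Fin p) λ ζ → υ ∈ F y × ζ ∈ F z × q ∈ T υ ζ)
    × ((u v : Fin p) → ¬ InProd (F y) (F z) u v →
        (q : Fin p) → q ∈ T u v → q ∉ F x)
  FulfillsLit F (x ≠ y) = F x ≢ F y

  Fulfills : ∀ {n} → Conjunction n → Set
  Fulfills {n} Φ = Σ (Fin n → Subset p) λ F → All (FulfillsLit F) Φ

{-# OPTIONS --safe #-}
-- Take as places the members of ⋃ M (as listed by the finite cover), label each variable x by the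
-- places in M x, and let the targets of a node {u , v} be the places equal to the set {u , v}.
-- Membership is well founded, so ranking the places puts every target above its sources; this
-- gives the topological order and accessibility, and the literals hold because M satisfies them.
-- Membership of iterative sets is not decidable, so this graph only exists under double negation;
-- but it is a finite table whose correctness is decidable, so exhaustive search finds one.
module Submission where

open import Defs
open import Data.Bool using (true; false)
open import Data.Bool.Properties using () renaming (_≟_ to _≟ᵇ_)
open import Data.Empty using (⊥-elim)
open import Data.Fin using (Fin; zero; suc; _<_; _<?_; _≟_; combine; punchIn; punchOut)
open import Data.Fin.Induction using (<-wellFounded)
open import Data.Fin.Properties
  using (any?; all?; <-cmp; <-irrefl; <-trans; combine-monoˡ-<; combine-injectiveʳ; punchIn-punchOut)
open import Data.Fin.Subset using (Subset; _∈_; _∉_; _⊆_; _∪_; _∩_; _─_; Nonempty; outside; inside)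
open import Data.Fin.Subset.Properties
  using (_∈?_; _⊆?_; nonempty?; anySubset?; ⊆-antisym; ∪-comm; ∩-comm;
         x∈p∪q⁺; x∈p∪q⁻; x∈p∩q⁺; x∈p∩q⁻; x∈p∧x∉q⇒x∈p─q; p─q⊆p)
open import Data.List using (List; length; lookup)
open import Data.List.Relation.Unary.All as All using (All)
open import Data.List.Relation.Unary.Any as Any using ()
open import Data.List.Relation.Unary.Any.Properties using (lookup-index)
open import Data.Nat using (ℕ; zero; suc; _*_; z≤n; s≤s)
open import Data.Product using (Σ; ∃; _×_; _,_; proj₁; proj₂)
open import Data.Sum as Sum using (_⊎_; inj₁; inj₂)
open import Data.Vec as Vec using (Vec; []; _∷_; tabulate)
open import Data.Vec.Properties using (≡-dec; lookup∘tabulate; []=⇒lookup; lookup⇒[]=)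
open import Function using (_∘_; _on_)
open import Induction.WellFounded using (Acc; acc; WellFounded)
open import Level using (0ℓ; lower)
open import Relation.Binary using (Rel; Decidable; Tri; tri<; tri≈; tri>; IsStrictTotalOrder)
open import Relation.Binary.Construct.On as On using ()
open import Relation.Binary.PropositionalEquality
  using (_≡_; refl; sym; trans; subst; subst₂; cong; cong₂; isEquivalence; resp₂)
open import Relation.Nullary using (¬_; Dec; yes; no; does; ¬?)
open import Relation.Nullary.Decidable
  using (map′; _×-dec_; _⊎-dec_; _→-dec_; decidable-stable; ¬¬-excluded-middle; dec-true)
open import Relation.Nullary.Negation using (¬¬-map; contradiction; ¬¬-Monad)
open import Effect.Monad using (RawMonad)

-- Iterative sets

≐-refl : ∀ x → x ≐ x
≐-refl (sup A f) = (λ a → a , ≐-refl (f a)) , (λ a → a , ≐-refl (f a))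

≐-sym : ∀ {x y} → x ≐ y → y ≐ x
≐-sym {sup A f} {sup B g} (f⊆g , g⊆f) =
  (λ b → proj₁ (g⊆f b) , ≐-sym (proj₂ (g⊆f b))) ,
  (λ a → proj₁ (f⊆g a) , ≐-sym (proj₂ (f⊆g a)))

≐-trans : ∀ {x y z} → x ≐ y → y ≐ z → x ≐ z
≐-trans {sup A f} {sup B g} {sup C h} (f⊆g , g⊆f) (g⊆h , h⊆g) =
  (λ a → let (b , fa≐gb) = f⊆g a ; (c , gb≐hc) = g⊆h b in c , ≐-trans fa≐gb gb≐hc) ,
  (λ c → let (b , gb≐hc) = h⊆g c ; (a , fa≐gb) = g⊆f b in a , ≐-trans fa≐gb gb≐hc)

∈-respˡ-≐ : ∀ {w w′ x} → w ≐ w′ → w ∈V x → w′ ∈V x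
∈-respˡ-≐ {x = sup A f} w≐w′ (a , w≐fa) = a , ≐-trans (≐-sym w≐w′) w≐fa

∈-respʳ-≐ : ∀ {w x y} → x ≐ y → w ∈V x → w ∈V y
∈-respʳ-≐ {x = sup A f} {sup B g} (f⊆g , _) (a , w≐fa) =
  proj₁ (f⊆g a) , ≐-trans w≐fa (proj₂ (f⊆g a))

≐-ext : ∀ {x y} → (∀ w → w ∈V x → w ∈V y) → (∀ w → w ∈V y → w ∈V x) → x ≐ y
≐-ext {sup A f} {sup B g} x⊆y y⊆x =
  (λ a → x⊆y (f a) (a , ≐-refl (f a))) ,
  (λ b → let (a , gb≐fa) = y⊆x (g b) (b , ≐-refl (g b)) in a , ≐-sym gb≐fa)

∈V-wellFounded : WellFounded _∈V_
∈V-wellFounded x = acc-≐ x (≐-refl x)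
  where
  acc-≐ : ∀ x {y} → y ≐ x → Acc _∈V_ y
  acc-≐ (sup A f) y≐x = acc λ w∈y →
    let (a , w≐fa) = ∈-respʳ-≐ y≐x w∈y in acc-≐ (f a) w≐fa

pairV-∈ˡ : ∀ u v → u ∈V pairV u v
pairV-∈ˡ u v = true , ≐-refl u

pairV-∈ʳ : ∀ u v → v ∈V pairV u v
pairV-∈ʳ u v = false , ≐-refl v

pairV-∈⁻ : ∀ {w u v} → w ∈V pairV u v → w ≐ u ⊎ w ≐ v
pairV-∈⁻ (true  , w≐u) = inj₁ w≐u
pairV-∈⁻ (false , w≐v) = inj₂ w≐v

pairV-comm : ∀ u v → pairV u v ≐ pairV v u
pairV-comm u v = (λ { true → false , ≐-refl u ; false → true , ≐-refl v })
               , (λ { true → false , ≐-refl v ; false → true , ≐-refl u })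

pairV-cong : ∀ {u u′ v v′} → u ≐ u′ → v ≐ v′ → pairV u v ≐ pairV u′ v′
pairV-cong u≐u′ v≐v′ = (λ { true → true , u≐u′ ; false → false , v≐v′ })
                     , (λ { true → true , u≐u′ ; false → false , v≐v′ })

pairV-∈-diagonal : ∀ {w x y c} → w ∈V pairV x y → x ≐ c → y ≐ c → w ≐ c
pairV-∈-diagonal w∈xy x≐c y≐c with pairV-∈⁻ w∈xy
... | inj₁ w≐x = ≐-trans w≐x x≐c
... | inj₂ w≐y = ≐-trans w≐y y≐c

pairV-injective : ∀ {x y a b} → pairV x y ≐ pairV a b → (x ≐ a × y ≐ b) ⊎ (x ≐ b × y ≐ a)
pairV-injective {x} {y} {a} {b} xy≐ab
  with pairV-∈⁻ (∈-respʳ-≐ xy≐ab (pairV-∈ˡ x y)) | pairV-∈⁻ (∈-respʳ-≐ xy≐ab (pairV-∈ʳ x y))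
... | inj₁ x≐a | inj₂ y≐b = inj₁ (x≐a , y≐b)
... | inj₂ x≐b | inj₁ y≐a = inj₂ (x≐b , y≐a)
... | inj₁ x≐a | inj₁ y≐a =
  inj₁ (x≐a , ≐-trans y≐a (≐-sym (pairV-∈-diagonal (∈-respʳ-≐ ab≐xy (pairV-∈ʳ a b)) x≐a y≐a)))
  where ab≐xy = ≐-sym xy≐ab
... | inj₂ x≐b | inj₂ y≐b =
  inj₂ (x≐b , ≐-trans y≐b (≐-sym (pairV-∈-diagonal (∈-respʳ-≐ ab≐xy (pairV-∈ˡ a b)) x≐b y≐b)))
  where ab≐xy = ≐-sym xy≐ab

-- Exhaustive search and double negation

Searchable : Set → Set₁
Searchable A = ∀ {P : A → Set} → (∀ a → Dec (P a)) → Dec (∃ P)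

search-× : ∀ {A B} → Searchable A → Searchable B → Searchable (A × B)
search-× searchA searchB P? =
  map′ (λ (a , b , Pab) → (a , b) , Pab) (λ ((a , b) , Pab) → a , b , Pab)
       (searchA λ a → searchB λ b → P? (a , b))

search-Vec : ∀ {A} → Searchable A → ∀ k → Searchable (Vec A k)
search-Vec searchA zero    P? = map′ ([] ,_) (λ { ([] , P[]) → P[] }) (P? [])
search-Vec searchA (suc k) P? =
  map′ (λ (a , as , P) → a ∷ as , P) (λ { (a ∷ as , P) → a , as , P })
       (searchA λ a → search-Vec searchA k λ as → P? (a ∷ as))

¬¬-Π-Fin : ∀ k {B : Fin k → Set} → (∀ i → ¬ ¬ B i) → ¬ ¬ (∀ i → B i)
¬¬-Π-Fin zero    _ = contradiction λ ()
¬¬-Π-Fin (suc k) ¬¬B = do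
  b₀ ← ¬¬B zero
  bs ← ¬¬-Π-Fin k (¬¬B ∘ suc)
  pure λ { zero → b₀ ; (suc i) → bs i }
  where open RawMonad ¬¬-Monad

-- Ranking a finite well-founded relation

minimal : ∀ {p} {R : Rel (Fin p) 0ℓ} → Decidable R → ∀ j → Acc R j → ∃ λ m → ∀ i → ¬ R i m
minimal R? j (acc rs) with any? (λ i → R? i j)
... | yes (i , Rij) = minimal R? i (rs Rij)
... | no  ¬∃        = j , λ i Rij → ¬∃ (i , Rij)

StrictRank : ∀ {p} → Rel (Fin p) 0ℓ → Set
StrictRank {p} R = Σ (Fin p → Fin p) λ rk → ∀ {i j} → R i j → rk i < rk j

-- A minimal element gets rank 0 and the remaining places are ranked recursively.
wellFounded⇒strictRank : ∀ p {R : Rel (Fin p) 0ℓ} → Decidable R → WellFounded R → StrictRank R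
wellFounded⇒strictRank zero    R? wf = (λ ()) , λ { {()} }
wellFounded⇒strictRank (suc p) {R} R? wf = rk , rk-mono
  where
  m = proj₁ (minimal R? zero (wf zero))
  rest = wellFounded⇒strictRank p (λ i j → R? (punchIn m i) (punchIn m j))
                                  (On.wellFounded (punchIn m) wf)

  rk : Fin (suc p) → Fin (suc p)
  rk j with m ≟ j
  ... | yes _   = zero
  ... | no  m≢j = suc (proj₁ rest (punchOut m≢j))

  rk-mono : ∀ {i j} → R i j → rk i < rk j
  rk-mono {i} {j} Rij with m ≟ j
  ... | yes refl = ⊥-elim (proj₂ (minimal R? zero (wf zero)) i Rij)
  ... | no  m≢j with m ≟ i
  ... | yes _   = s≤s z≤n
  ... | no  m≢i =
    s≤s (proj₂ rest (subst₂ R (sym (punchIn-punchOut m≢i)) (sym (punchIn-punchOut m≢j)) Rij))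

toSubset : ∀ {k} {P : Fin k → Set} → (∀ q → Dec (P q)) → Subset k
toSubset P? = tabulate (does ∘ P?)

∈-toSubset⁺ : ∀ {k} {P : Fin k → Set} (P? : ∀ q → Dec (P q)) {q} → P q → q ∈ toSubset P?
∈-toSubset⁺ P? {q} Pq = lookup⇒[]= q _ (trans (lookup∘tabulate (does ∘ P?) q) (dec-true (P? q) Pq))

∈-toSubset⁻ : ∀ {k} {P : Fin k → Set} (P? : ∀ q → Dec (P q)) {q} → q ∈ toSubset P? → P q
∈-toSubset⁻ P? {q} q∈P with P? q | trans (sym (lookup∘tabulate (does ∘ P?) q)) ([]=⇒lookup q∈P)
... | yes Pq | _ = Pq

x∈p─q⇒x∉q : ∀ {k} {x : Fin k} (p q : Subset k) → x ∈ p ─ q → x ∉ q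
x∈p─q⇒x∉q (_ ∷ p) (outside ∷ q) (Vec.there x∈p─q) (Vec.there x∈q) = x∈p─q⇒x∉q p q x∈p─q x∈q
x∈p─q⇒x∉q (_ ∷ p) (inside  ∷ q) (Vec.there x∈p─q) (Vec.there x∈q) = x∈p─q⇒x∉q p q x∈p─q x∈q

module _ {p : ℕ} (G : OrderedGraph p) where
  open OrderedGraph G

  TargetsAbove : Set
  TargetsAbove = ∀ u v q → q ∈ T u v → u ≺ q × v ≺ q

  targetsAbove⇒accessible : WellFounded _≺_ → TargetsAbove → IsAccessible G
  targetsAbove⇒accessible wf above q = go q (wf q)
    where
    go : ∀ q → Acc _≺_ q → Accessible G q
    go q (acc rs) with any? (λ u → any? λ v → q ∈? T u v)
    ... | yes (u , v , q∈Tuv) =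
      let (u≺q , v≺q) = above u v q q∈Tuv in step u v (go u (rs u≺q)) (go v (rs v≺q)) q∈Tuv
    ... | no  ¬∃ = src λ u v q∈Tuv → ¬∃ (u , v , q∈Tuv)

  fulfillsLit? : ∀ {n} (F : Fin n → Subset p) (l : Literal n) → Dec (FulfillsLit G F l)
  fulfillsLit? F (x ≔ y ∪ z) = ≡-dec _≟ᵇ_ (F x) (F y ∪ F z)
  fulfillsLit? F (x ≔ y ∖ z) = ≡-dec _≟ᵇ_ (F x) (F y ─ F z)
  fulfillsLit? F (x ≠ y)     = ¬? (≡-dec _≟ᵇ_ (F x) (F y))
  fulfillsLit? F (x ≔ y ⊗ z) = c1? ×-dec c2? ×-dec c3?
    where
    c1? = all? λ υ → all? λ ζ → υ ∈? F y →-dec ζ ∈? F z →-dec nonempty? (T υ ζ) ×-dec T υ ζ ⊆? F x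
    c2? = all? λ q → q ∈? F x →-dec
            any? λ υ → any? λ ζ → υ ∈? F y ×-dec ζ ∈? F z ×-dec q ∈? T υ ζ
    inProd? : ∀ u v → Dec (InProd G (F y) (F z) u v)
    inProd? u v = any? λ υ → any? λ ζ → υ ∈? F y ×-dec ζ ∈? F z ×-dec
                    (u ≟ υ ×-dec v ≟ ζ ⊎-dec u ≟ ζ ×-dec v ≟ υ)
    c3? = all? λ u → all? λ v → ¬? (inProd? u v) →-dec all? λ q → q ∈? T u v →-dec ¬? (q ∈? F x)

-- Ordered ⊗-graphs encoded by finite tables

-- A rank for each place, raw target sets for each ordered pair of places, and the labels F x.
Table : ℕ → ℕ → Set
Table p n = Vec (Fin p) p × Vec (Vec (Subset p) p) p × Vec (Subset p) n

search-Table : ∀ p n → Searchable (Table p n)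
search-Table p n =
  search-× (search-Vec any? p)
           (search-× (search-Vec (search-Vec anySubset? p) p) (search-Vec anySubset? n))

module TableGraph {p n : ℕ} (t : Table p n) where

  rank : Fin p → Fin p
  rank = Vec.lookup (proj₁ t)

  rawTargets : Fin p → Fin p → Subset p
  rawTargets u v = Vec.lookup (Vec.lookup (proj₁ (proj₂ t)) u) v

  labels : Fin n → Subset p
  labels = Vec.lookup (proj₂ (proj₂ t))

  -- Ties in rank are broken by the place itself, making the order total.
  key : Fin p → Fin (p * p)
  key i = combine (rank i) i

  _≺_ : Rel (Fin p) 0ℓ
  _≺_ = _<_ on key

  ≺-wellFounded : WellFounded _≺_
  ≺-wellFounded = On.wellFounded key <-wellFounded

  ≺-isStrictTotalOrder : IsStrictTotalOrder _≡_ _≺_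
  ≺-isStrictTotalOrder = record
    { isStrictPartialOrder = record
      { isEquivalence = isEquivalence
      ; irrefl        = λ { refl → <-irrefl refl }
      ; trans         = <-trans
      ; <-resp-≈      = resp₂ _≺_
      }
    ; compare = compare
    }
    where
    compare : ∀ i j → Tri (i ≺ j) (i ≡ j) (j ≺ i)
    compare i j with <-cmp (key i) (key j)
    ... | tri< i≺j i≢j j⊀i = tri< i≺j (λ { refl → i≢j refl }) j⊀i
    ... | tri≈ i⊀j i≡j j⊀i = tri≈ i⊀j (combine-injectiveʳ (rank i) i (rank j) j i≡j) j⊀i
    ... | tri> i⊀j i≢j j≺i = tri> i⊀j (λ { refl → i≢j refl }) j≺i

  above : Fin p → Subset p
  above u = toSubset λ q → key u <? key q

  ∈-above⁺ : ∀ {u q} → u ≺ q → q ∈ above u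
  ∈-above⁺ {u} = ∈-toSubset⁺ (λ q → key u <? key q)

  ∈-above⁻ : ∀ {u q} → q ∈ above u → u ≺ q
  ∈-above⁻ {u} = ∈-toSubset⁻ (λ q → key u <? key q)

  -- Symmetrising the raw targets and cutting them down to the places above both sources makes
  -- every table a valid ordered ⊗-graph.
  T : Fin p → Fin p → Subset p
  T u v = (rawTargets u v ∪ rawTargets v u) ∩ (above u ∩ above v)

  T-sym : ∀ u v → T u v ≡ T v u
  T-sym u v = cong₂ _∩_ (∪-comm (rawTargets u v) (rawTargets v u)) (∩-comm (above u) (above v))

  T-above : ∀ {u v q} → q ∈ T u v → u ≺ q × v ≺ q
  T-above {u} {v} q∈T =
    let (_ , q∈above) = x∈p∩q⁻ _ _ q∈T
        (q∈aboveu , q∈abovev) = x∈p∩q⁻ (above u) (above v) q∈above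
    in ∈-above⁻ q∈aboveu , ∈-above⁻ q∈abovev

  graph : OrderedGraph p
  graph = record
    { T     = T
    ; T-sym = T-sym
    ; _≺_   = _≺_
    ; ≺-sto = ≺-isStrictTotalOrder
    ; topo  = λ u v _ m m′ (m∈uv , _) (m′∈T , _) → max≺target m∈uv m′∈T
    }
    where
    max≺target : ∀ {u v m m′} → m ≡ u ⊎ m ≡ v → m′ ∈ T u v → m ≺ m′
    max≺target (inj₁ refl) m′∈T = proj₁ (T-above m′∈T)
    max≺target (inj₂ refl) m′∈T = proj₂ (T-above m′∈T)

  graph-accessible : IsAccessible graph
  graph-accessible = targetsAbove⇒accessible graph ≺-wellFounded (λ _ _ _ → T-above)

  Fulfilled : Conjunction n → Set
  Fulfilled Φ = All (FulfillsLit graph labels) Φ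

  fulfilled? : ∀ Φ → Dec (Fulfilled Φ)
  fulfilled? = All.all? (fulfillsLit? graph labels)

-- Graphs representing a finite model

module Representation
  {p n : ℕ} (G : OrderedGraph p) (M : Fin n → V) (ℓ : Fin p → V) (F : Fin n → Subset p)
  (F⁺ : ∀ {q x} → ℓ q ∈V M x → q ∈ F x)
  (F⁻ : ∀ {q x} → q ∈ F x → ℓ q ∈V M x)
  (T⁺ : ∀ {u v q} → ℓ q ≐ pairV (ℓ u) (ℓ v) → q ∈ OrderedGraph.T G u v)
  (T⁻ : ∀ {u v q} → q ∈ OrderedGraph.T G u v → ℓ q ≐ pairV (ℓ u) (ℓ v))
  (cover : ∀ {x w} → w ∈V M x → ∃ λ q → w ≐ ℓ q)
  where
  open OrderedGraph G

  ∈F : ∀ {x w q} → w ≐ ℓ q → w ∈V M x → q ∈ F x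
  ∈F w≐ℓq w∈Mx = F⁺ (∈-respˡ-≐ w≐ℓq w∈Mx)

  placeOf : ∀ {x w} → w ∈V M x → ∃ λ q → q ∈ F x × w ≐ ℓ q
  placeOf w∈Mx = let (q , w≐ℓq) = cover w∈Mx in q , ∈F w≐ℓq w∈Mx , w≐ℓq

  labels-injective : ∀ {x y} → F x ≡ F y → M x ≐ M y
  labels-injective Fx≡Fy = ≐-ext (transfer Fx≡Fy) (transfer (sym Fx≡Fy))
    where
    transfer : ∀ {x y} → F x ≡ F y → ∀ w → w ∈V M x → w ∈V M y
    transfer Fx≡Fy w w∈Mx =
      let (q , q∈Fx , w≐ℓq) = placeOf w∈Mx
      in ∈-respˡ-≐ (≐-sym w≐ℓq) (F⁻ (subst (q ∈_) Fx≡Fy q∈Fx))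

  satLit⇒fulfillsLit : ∀ l → SatLit M l → FulfillsLit G F l
  satLit⇒fulfillsLit (x ≔ y ∪ z) sat = ⊆-antisym
    (λ {q} q∈Fx → x∈p∪q⁺ (Sum.map F⁺ F⁺ (proj₁ (sat (ℓ q)) (F⁻ q∈Fx))))
    (λ {q} q∈F → F⁺ (proj₂ (sat (ℓ q)) (Sum.map F⁻ F⁻ (x∈p∪q⁻ (F y) (F z) q∈F))))
  satLit⇒fulfillsLit (x ≔ y ∖ z) sat = ⊆-antisym
    (λ {q} q∈Fx → let (ℓq∈My , ℓq∉Mz) = proj₁ (sat (ℓ q)) (F⁻ q∈Fx)
                  in x∈p∧x∉q⇒x∈p─q (F⁺ ℓq∈My) (ℓq∉Mz ∘ F⁻))
    (λ {q} q∈F → F⁺ (proj₂ (sat (ℓ q))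
       (F⁻ (p─q⊆p (F y) (F z) q∈F) , x∈p─q⇒x∉q (F y) (F z) q∈F ∘ F⁺)))
  satLit⇒fulfillsLit (x ≠ y) sat Fx≡Fy = lower sat (labels-injective Fx≡Fy)
  satLit⇒fulfillsLit (x ≔ y ⊗ z) sat = targets-inside , targets-cover , targets-outside
    where
    targets-inside : ∀ υ ζ → υ ∈ F y → ζ ∈ F z → Nonempty (T υ ζ) × T υ ζ ⊆ F x
    targets-inside υ ζ υ∈Fy ζ∈Fz = nonempty , T⊆Fx
      where
      ∈Mx : ∀ {w} → w ≐ pairV (ℓ υ) (ℓ ζ) → w ∈V M x
      ∈Mx {w} w≐υζ = proj₂ (sat w) (ℓ υ , ℓ ζ , F⁻ υ∈Fy , F⁻ ζ∈Fz , w≐υζ)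
      nonempty : Nonempty (T υ ζ)
      nonempty = let (q , υζ≐ℓq) = cover (∈Mx (≐-refl _)) in q , T⁺ (≐-sym υζ≐ℓq)
      T⊆Fx : T υ ζ ⊆ F x
      T⊆Fx q∈T = F⁺ (∈Mx (T⁻ q∈T))

    targets-cover : ∀ q → q ∈ F x → ∃ λ υ → ∃ λ ζ → υ ∈ F y × ζ ∈ F z × q ∈ T υ ζ
    targets-cover q q∈Fx =
      let (a , b , a∈My , b∈Mz , ℓq≐ab) = proj₁ (sat (ℓ q)) (F⁻ q∈Fx)
          (υ , υ∈Fy , a≐ℓυ) = placeOf a∈My
          (ζ , ζ∈Fz , b≐ℓζ) = placeOf b∈Mz
      in υ , ζ , υ∈Fy , ζ∈Fz , T⁺ (≐-trans ℓq≐ab (pairV-cong a≐ℓυ b≐ℓζ))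

    targets-outside : ∀ u v → ¬ InProd G (F y) (F z) u v → ∀ q → q ∈ T u v → q ∉ F x
    targets-outside u v ¬uv∈FyFz q q∈T q∈Fx
      with proj₁ (sat (ℓ q)) (F⁻ q∈Fx)
    ... | a , b , a∈My , b∈Mz , ℓq≐ab with pairV-injective (≐-trans (≐-sym (T⁻ q∈T)) ℓq≐ab)
    ... | inj₁ (ℓu≐a , ℓv≐b) =
      ¬uv∈FyFz (u , v , ∈F (≐-sym ℓu≐a) a∈My , ∈F (≐-sym ℓv≐b) b∈Mz , inj₁ (refl , refl))
    ... | inj₂ (ℓu≐b , ℓv≐a) =
      ¬uv∈FyFz (v , u , ∈F (≐-sym ℓv≐a) a∈My , ∈F (≐-sym ℓu≐b) b∈Mz , inj₂ (refl , refl))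

-- The membership graph of a finite model

module MembershipTable {n : ℕ} (M : Fin n → V) (finite : FiniteUnion M) where

  Ls : List V
  Ls = proj₁ finite

  ℓ : Fin (length Ls) → V
  ℓ = lookup Ls

  cover : ∀ {x w} → w ∈V M x → ∃ λ q → w ≐ ℓ q
  cover {x} {w} w∈Mx = let w∈Ls = proj₂ finite x w w∈Mx in Any.index w∈Ls , lookup-index w∈Ls

  Decisions : Set
  Decisions = (∀ q x → Dec (ℓ q ∈V M x))
            × (∀ u v q → Dec (ℓ q ≐ pairV (ℓ u) (ℓ v)))
            × (∀ i j → Dec (ℓ i ∈V ℓ j))

  ¬¬-decisions : ¬ ¬ Decisions
  ¬¬-decisions = do
    ∈M? ← ¬¬-Π-Fin _ λ q → ¬¬-Π-Fin n λ x → ¬¬-excluded-middle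
    ≐pair? ← ¬¬-Π-Fin _ λ u → ¬¬-Π-Fin _ λ v → ¬¬-Π-Fin _ λ q → ¬¬-excluded-middle
    ∈ℓ? ← ¬¬-Π-Fin _ λ i → ¬¬-Π-Fin _ λ j → ¬¬-excluded-middle
    pure (∈M? , ≐pair? , ∈ℓ?)
    where open RawMonad ¬¬-Monad

  module _ (d : Decisions) where
    private
      ∈M? = proj₁ d
      ≐pair? = proj₁ (proj₂ d)
      strictRank = wellFounded⇒strictRank _ (proj₂ (proj₂ d)) (On.wellFounded ℓ ∈V-wellFounded)

    table : Table (length Ls) n
    table = tabulate (proj₁ strictRank)
          , tabulate (λ u → tabulate λ v → toSubset (≐pair? u v))
          , tabulate (λ x → toSubset λ q → ∈M? q x)

    open TableGraph table

    labels≡ : ∀ x → labels x ≡ toSubset (λ q → ∈M? q x)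
    labels≡ = lookup∘tabulate _

    rawTargets≡ : ∀ u v → rawTargets u v ≡ toSubset (≐pair? u v)
    rawTargets≡ u v = trans (cong (λ r → Vec.lookup r v) (lookup∘tabulate _ u)) (lookup∘tabulate _ v)

    rank≡ : ∀ i → rank i ≡ proj₁ strictRank i
    rank≡ = lookup∘tabulate (proj₁ strictRank)

    ∈⇒≺ : ∀ {i j} → ℓ i ∈V ℓ j → i ≺ j
    ∈⇒≺ {i} {j} ℓi∈ℓj = subst₂ (λ a b → combine a i < combine b j) (sym (rank≡ i)) (sym (rank≡ j))
      (combine-monoˡ-< i j (proj₂ strictRank ℓi∈ℓj))

    labels⁺ : ∀ {q x} → ℓ q ∈V M x → q ∈ labels x
    labels⁺ {q} {x} ℓq∈Mx = subst (q ∈_) (sym (labels≡ x)) (∈-toSubset⁺ (λ q → ∈M? q x) ℓq∈Mx)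

    labels⁻ : ∀ {q x} → q ∈ labels x → ℓ q ∈V M x
    labels⁻ {q} {x} q∈Fx = ∈-toSubset⁻ (λ q → ∈M? q x) (subst (q ∈_) (labels≡ x) q∈Fx)

    T⁺ : ∀ {u v q} → ℓ q ≐ pairV (ℓ u) (ℓ v) → q ∈ T u v
    T⁺ {u} {v} {q} ℓq≐uv =
      x∈p∩q⁺ (x∈p∪q⁺ (inj₁ q∈raw) , x∈p∩q⁺ (∈-above⁺ (∈⇒≺ ℓu∈ℓq) , ∈-above⁺ (∈⇒≺ ℓv∈ℓq)))
      where
      q∈raw = subst (q ∈_) (sym (rawTargets≡ u v)) (∈-toSubset⁺ (≐pair? u v) ℓq≐uv)
      ℓu∈ℓq = ∈-respʳ-≐ (≐-sym ℓq≐uv) (pairV-∈ˡ (ℓ u) (ℓ v))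
      ℓv∈ℓq = ∈-respʳ-≐ (≐-sym ℓq≐uv) (pairV-∈ʳ (ℓ u) (ℓ v))

    T⁻ : ∀ {u v q} → q ∈ T u v → ℓ q ≐ pairV (ℓ u) (ℓ v)
    T⁻ {u} {v} {q} q∈T with x∈p∪q⁻ (rawTargets u v) (rawTargets v u) (proj₁ (x∈p∩q⁻ _ _ q∈T))
    ... | inj₁ q∈uv = ∈-toSubset⁻ (≐pair? u v) (subst (q ∈_) (rawTargets≡ u v) q∈uv)
    ... | inj₂ q∈vu =
      ≐-trans (∈-toSubset⁻ (≐pair? v u) (subst (q ∈_) (rawTargets≡ v u) q∈vu)) (pairV-comm (ℓ v) (ℓ u))

    open Representation graph M ℓ labels labels⁺ labels⁻ T⁺ T⁻ cover public using (satLit⇒fulfillsLit)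

  ¬¬-fulfillingTable : ∀ {Φ} → All (SatLit M) Φ → ¬ ¬ (∃ λ t → TableGraph.Fulfilled t Φ)
  ¬¬-fulfillingTable sat = ¬¬-map (λ d → table d , All.map (satLit⇒fulfillsLit d _) sat) ¬¬-decisions

lemma15 : {n : ℕ} (Φ : Conjunction n) → FinitelySatisfiable Φ →
          Σ ℕ λ p → Σ (OrderedGraph p) λ G → IsAccessible G × Fulfills G Φ
lemma15 {n} Φ (M , sat , finite@(Ls , _)) = length Ls , graph , graph-accessible , labels , fulfilled
  where
  found : ∃ λ t → TableGraph.Fulfilled t Φ
  found = decidable-stable (search-Table (length Ls) n λ t → TableGraph.fulfilled? t Φ)
                           (MembershipTable.¬¬-fulfillingTable M finite sat)
  open TableGraph (proj₁ found)
  fulfilled = proj₂ found
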